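{- Let $D$ be the derivation of $\mathbb{Q}[X,Y,Z]$ with $D(X)=YZ$, $D(Y)=XZ$, $D(Z)=XY$. Define $(DX)^0(Y)=Y$, $(DX)^{n+1}(Y)=D\big(X\,(DX)^n(Y)\big)$ and integers $d_{n,i,j}$ by $$(DX)^{2n}(Y)=\sum_{i,j\ge0}d_{2n,i,j}X^{2i}Y^{2j+1}Z^{4n-2i-2j},\qquad (DX)^{2n+1}(Y)=\sum_{i,j\ge0}d_{2n+1,i,j}X^{2i}Y^{2j}Z^{4n-2i-2j+3}.$$ Let $\mathcal{D}(x,p,q)=\sum_{n,i,j}d_{n,i,j}\frac{x^n}{n!}p^iq^j$ with even part $DE=\frac12(\mathcal D(x,p,q)+\mathcal D(-x,p,q))$ and odd part $DO=\frac12(\mathcal D(x,p,q)-\mathcal D(-x,p,q))$ in $x$. Then $$DO_x=(p+q)DE+2pq(1-p)DE_p+2pq(1-q)DE_q+2pqxDE_x,\qquad DE_x=(1+p)DO+2p(1-p)DO_p+2p(1-q)DO_q+2pxDO_x.$$ Equivalently, $(DO',DE')$ with $DO'=\sqrt{\frac{p}{p-1}}DO$ and $DE'=\sqrt{\frac{pq}{p-1}}DE$ is a $J$-pair of the first type.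
   Context: Subscripts denote partial derivatives. A pair $(F,G)$ of functions of $(x,p,q)$ is a $J$-pair of the first type if $F_x=2p\sqrt{q}(1-p)G_p+2p\sqrt{q}(1-q)G_q+2p\sqrt{q}\,xG_x$ and $G_x=2p\sqrt{q}(1-p)F_p+2p\sqrt{q}(1-q)F_q+2p\sqrt{q}\,xF_x$. (The generating function called $D(x,p,q)$ in the paper is written $\mathcal D$ here to avoid a clash with the derivation $D$.) -}

module Defs where

open import Data.Nat as ℕ using (ℕ; zero; suc; _∸_; _≤?_; _!)
open import Data.Nat.Properties using (_!≢0)
open import Data.Nat.DivMod using (_%_) renaming (_/_ to _div_)
open import Data.Integer as ℤ using (ℤ)
open import Data.Rational as ℚ using (ℚ; ½)
open import Relation.Nullary using (yes; no)

-- Polynomials in ℚ[X,Y,Z] (here with integer coefficients, which is all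
-- that is ever produced from Y by D and multiplication by X), represented
-- by their coefficient function:  P a b c = coefficient of X^a Y^b Z^c.

Poly : Set
Poly = ℕ → ℕ → ℕ → ℤ

polyY : Poly
polyY zero (suc zero) zero = ℤ.+ 1
polyY _    _          _    = ℤ.+ 0

mulX : Poly → Poly
mulX P zero    b c = ℤ.+ 0
mulX P (suc a) b c = P a b c

-- The derivation D with D(X) = YZ, D(Y) = XZ, D(Z) = XY, written out
-- coefficientwise:  D(X^α Y^β Z^γ) = α X^(α-1) Y^(β+1) Z^(γ+1)
--   + β X^(α+1) Y^(β-1) Z^(γ+1) + γ X^(α+1) Y^(β+1) Z^(γ-1).
-- Contribution to X^a Y^b Z^c from the first / second / third term:
derX : Poly → Poly   -- from α = a+1, β = b-1, γ = c-1
derX P a (suc b) (suc c) = ℤ.+ (suc a) ℤ.* P (suc a) b c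
derX P _ _ _ = ℤ.+ 0

derY : Poly → Poly   -- from α = a-1, β = b+1, γ = c-1
derY P (suc a) b (suc c) = ℤ.+ (suc b) ℤ.* P a (suc b) c
derY P _ _ _ = ℤ.+ 0

derZ : Poly → Poly   -- from α = a-1, β = b-1, γ = c+1
derZ P (suc a) (suc b) c = ℤ.+ (suc c) ℤ.* P a b (suc c)
derZ P _ _ _ = ℤ.+ 0

D : Poly → Poly
D P a b c = derX P a b c ℤ.+ derY P a b c ℤ.+ derZ P a b c

DXpow : ℕ → Poly
DXpow zero    = polyY
DXpow (suc n) = D (mulX (DXpow n))

dEven : ℕ → ℕ → ℕ → ℤ
dEven m i j with (2 ℕ.* i ℕ.+ 2 ℕ.* j) ≤? (4 ℕ.* m)
... | yes _ = DXpow (2 ℕ.* m) (2 ℕ.* i) (suc (2 ℕ.* j)) ((4 ℕ.* m) ∸ (2 ℕ.* i ℕ.+ 2 ℕ.* j))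
... | no  _ = ℤ.+ 0

dOdd : ℕ → ℕ → ℕ → ℤ
dOdd m i j with (2 ℕ.* i ℕ.+ 2 ℕ.* j) ≤? (4 ℕ.* m ℕ.+ 3)
... | yes _ = DXpow (suc (2 ℕ.* m)) (2 ℕ.* i) (2 ℕ.* j) ((4 ℕ.* m ℕ.+ 3) ∸ (2 ℕ.* i ℕ.+ 2 ℕ.* j))
... | no  _ = ℤ.+ 0

d : ℕ → ℕ → ℕ → ℤ
d n i j with n % 2
... | zero  = dEven (n div 2) i j
... | suc _ = dOdd  (n div 2) i j

-- Formal power series in x, p, q over ℚ, by coefficient function:
-- F n i j = coefficient of x^n p^i q^j.

PS : Set
PS = ℕ → ℕ → ℕ → ℚ

_⊕_ : PS → PS → PS
(F ⊕ G) n i j = F n i j ℚ.+ G n i j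
infixl 6 _⊕_

_⊖_ : PS → PS → PS
(F ⊖ G) n i j = F n i j ℚ.- G n i j
infixl 6 _⊖_

_⊙_ : ℚ → PS → PS
(c ⊙ F) n i j = c ℚ.* F n i j
infixr 7 _⊙_

mul-x : PS → PS
mul-x F zero    i j = ℚ.0ℚ
mul-x F (suc n) i j = F n i j

mul-p : PS → PS
mul-p F n zero    j = ℚ.0ℚ
mul-p F n (suc i) j = F n i j

mul-q : PS → PS
mul-q F n i zero    = ℚ.0ℚ
mul-q F n i (suc j) = F n i j

∂x : PS → PS
∂x F n i j = (ℤ.+ suc n ℚ./ 1) ℚ.* F (suc n) i j

∂p : PS → PS
∂p F n i j = (ℤ.+ suc i ℚ./ 1) ℚ.* F n (suc i) j

∂q : PS → PS
∂q F n i j = (ℤ.+ suc j ℚ./ 1) ℚ.* F n i (suc j)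

neg-x : PS → PS
neg-x F zero    i j = F zero i j
neg-x F (suc n) i j = ℚ.- neg-x (λ m → F (suc m)) n i j

𝒟 : PS
𝒟 n i j = (d n i j ℚ./ (n !)) {{n !≢0}}

DE : PS
DE = ½ ⊙ (𝒟 ⊕ neg-x 𝒟)

DO : PS
DO = ½ ⊙ (𝒟 ⊖ neg-x 𝒟)

2ℚ : ℚ
2ℚ = ℤ.+ 2 ℚ./ 1

module Submission where

open import Defs
open import Data.Nat using (ℕ)
open import Data.Rational using (ℚ)
open import Relation.Binary.PropositionalEquality using (_≡_)
open import Data.Product using (_×_)

open import Data.Nat as ℕ using (zero; suc; _+_; _∸_; _≤_; _<_; _≤?_; s≤s; z≤n; _!)
import Data.Nat.Properties as ℕP
open import Data.Nat.Properties using (_!≢0)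
open import Data.Nat.DivMod using (_%_; m/n≡1+[m∸n]/n) renaming (_/_ to _div_)
open import Data.Nat.Tactic.RingSolver using (solve-∀)
open import Data.Integer as ℤ using (ℤ; +_)
import Data.Integer.Properties as ℤP
open import Data.Rational as ℚ using (½)
import Data.Rational.Properties as ℚP
import Data.Rational.Unnormalised as ℚᵘ
import Data.Rational.Unnormalised.Properties as ℚᵘP
open import Data.Rational.Solver using (module +-*-Solver)
open +-*-Solver using (solve; _:=_; _:+_; _:*_; _:-_; :-_; con)
open import Algebra.Properties.Group ℚP.+-0-group using (⁻¹-involutive)
open import Data.Product using (_,_)
open import Data.Sum using (inj₁; inj₂)
open import Data.Empty using (⊥-elim)
open import Relation.Nullary using (yes; no)
open import Relation.Binary.PropositionalEquality

-- Both sides are compared coefficientwise.  At x^n the left-hand side only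
-- involves d_{n+1,·,·} and the right-hand side only d_{n,·,·}, so the
-- lemma amounts to two integer recurrences
--   d_{2m+1} = RA (2m) d_{2m},    d_{2m+2} = RB (2m+1) d_{2m+1},
-- obtained by expanding (DX)^{n+1}(Y) = D(X·(DX)^n(Y)) monomial by monomial:
-- the three terms of D (through X, Y and Z) give the three summands.
--
-- At slices of
-- the wrong parity both sides vanish.

-- Doubling with the recursion  double (suc n) = suc (suc (double n)),  so
-- that exponents 2i+2 are visibly successors when D is unfolded.
double : ℕ → ℕ
double zero    = zero
double (suc n) = suc (suc (double n))

double≡2* : ∀ n → double n ≡ 2 ℕ.* n
double≡2* zero    = refl
double≡2* (suc n) = cong suc (trans (cong suc (double≡2* n)) (sym (ℕP.+-suc n (n + 0))))

data Compare (k N : ℕ) : Set where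
  within : ∀ t → k + t ≡ N → Compare k N
  beyond : N < k → Compare k N

compare : ∀ k N → Compare k N
compare k N with k ≤? N
... | yes k≤N = within (N ∸ k) (ℕP.m+[n∸m]≡n k≤N)
... | no  k≰N = beyond (ℕP.≰⇒> k≰N)

2*-distrib₃ : ∀ i j t → 2 ℕ.* (i + j + t) ≡ 2 ℕ.* i + 2 ℕ.* j + 2 ℕ.* t
2*-distrib₃ = solve-∀

4*≡2*2* : ∀ m → 4 ℕ.* m ≡ 2 ℕ.* (2 ℕ.* m)
4*≡2*2* = solve-∀

suc-mid : ∀ i j t → i + suc j + t ≡ suc (i + j + t)
suc-mid = solve-∀

suc-end : ∀ i j t → i + j + suc t ≡ suc (i + j + t)
suc-end = solve-∀

module _ (m i j : ℕ) where

  private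
    k : ℕ
    k = 2 ℕ.* i + 2 ℕ.* j

    cutoff-∸ : ∀ {N} c → k + c ≡ N → N ∸ k ≡ c
    cutoff-∸ c refl = ℕP.m+n∸m≡n k c

    cutoff-≤ : ∀ {N} c → k + c ≡ N → k ≤ N
    cutoff-≤ c refl = ℕP.m≤m+n k c

  dEven-at : ∀ c → k + c ≡ 4 ℕ.* m → dEven m i j ≡ DXpow (2 ℕ.* m) (2 ℕ.* i) (suc (2 ℕ.* j)) c
  dEven-at c e with k ≤? 4 ℕ.* m
  ... | yes _   = cong (DXpow (2 ℕ.* m) (2 ℕ.* i) (suc (2 ℕ.* j))) (cutoff-∸ c e)
  ... | no  k≰N = ⊥-elim (k≰N (cutoff-≤ c e))

  dEven-beyond : 4 ℕ.* m < k → dEven m i j ≡ + 0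
  dEven-beyond N<k with k ≤? 4 ℕ.* m
  ... | yes k≤N = ⊥-elim (ℕP.<⇒≱ N<k k≤N)
  ... | no  _   = refl

  dOdd-at : ∀ c → k + c ≡ 4 ℕ.* m + 3 → dOdd m i j ≡ DXpow (suc (2 ℕ.* m)) (2 ℕ.* i) (2 ℕ.* j) c
  dOdd-at c e with k ≤? 4 ℕ.* m + 3
  ... | yes _   = cong (DXpow (suc (2 ℕ.* m)) (2 ℕ.* i) (2 ℕ.* j)) (cutoff-∸ c e)
  ... | no  k≰N = ⊥-elim (k≰N (cutoff-≤ c e))

  dOdd-beyond : 4 ℕ.* m + 3 < k → dOdd m i j ≡ + 0
  dOdd-beyond N<k with k ≤? 4 ℕ.* m + 3
  ... | yes k≤N = ⊥-elim (ℕP.<⇒≱ N<k k≤N)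
  ... | no  _   = refl

-- The same readings in halved coordinates: for (DX)^(2m)(Y) the monomial
-- X^(2i) Y^(2j+1) Z^(2t) lies in degree 4m+1 iff i + j + t = 2m, and for
-- (DX)^(2m+1)(Y) the monomial X^(2i) Y^(2j) Z^(2t+1) lies in degree 4m+3
-- iff i + j + t = 2m+1.
module _ (m i j : ℕ) where

  private
    doubled : ∀ {t N} → i + j + t ≡ N → 2 ℕ.* i + 2 ℕ.* j + 2 ℕ.* t ≡ 2 ℕ.* N
    doubled {t} e = trans (sym (2*-distrib₃ i j t)) (cong (2 ℕ.*_) e)

  dEven-within : ∀ t → i + j + t ≡ double m →
                 dEven m i j ≡ DXpow (double m) (double i) (suc (double j)) (double t)
  dEven-within t e rewrite double≡2* m | double≡2* i | double≡2* j | double≡2* t =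
    dEven-at m i j (2 ℕ.* t) (trans (doubled e) (sym (4*≡2*2* m)))

  dEven-past : double m < i + j → dEven m i j ≡ + 0
  dEven-past lt rewrite double≡2* m = dEven-beyond m i j (begin-strict
      4 ℕ.* m             ≡⟨ 4*≡2*2* m ⟩
      2 ℕ.* (2 ℕ.* m)     <⟨ ℕP.*-monoʳ-< 2 lt ⟩
      2 ℕ.* (i + j)       ≡⟨ ℕP.*-distribˡ-+ 2 i j ⟩
      2 ℕ.* i + 2 ℕ.* j   ∎)
    where open ℕP.≤-Reasoning

  dOdd-within : ∀ t → i + j + t ≡ suc (double m) →
                dOdd m i j ≡ DXpow (suc (double m)) (double i) (double j) (suc (double t))
  dOdd-within t e rewrite double≡2* m | double≡2* i | double≡2* j | double≡2* t =
    dOdd-at m i j (suc (2 ℕ.* t)) (begin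
      2 ℕ.* i + 2 ℕ.* j + suc (2 ℕ.* t)  ≡⟨ ℕP.+-suc (2 ℕ.* i + 2 ℕ.* j) (2 ℕ.* t) ⟩
      suc (2 ℕ.* i + 2 ℕ.* j + 2 ℕ.* t)  ≡⟨ cong suc (doubled e) ⟩
      suc (2 ℕ.* suc (2 ℕ.* m))          ≡⟨ odd-degree m ⟩
      4 ℕ.* m + 3                        ∎)
    where
    open ≡-Reasoning
    odd-degree : ∀ m → suc (2 ℕ.* suc (2 ℕ.* m)) ≡ 4 ℕ.* m + 3
    odd-degree = solve-∀

  dOdd-past : suc (double m) < i + j → dOdd m i j ≡ + 0
  dOdd-past lt rewrite double≡2* m = dOdd-beyond m i j (begin-strict
      4 ℕ.* m + 3                  <⟨ ℕP.n<1+n _ ⟩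
      suc (4 ℕ.* m + 3)            ≡⟨ even-bound m ⟩
      2 ℕ.* suc (suc (2 ℕ.* m))    ≤⟨ ℕP.*-monoʳ-≤ 2 lt ⟩
      2 ℕ.* (i + j)                ≡⟨ ℕP.*-distribˡ-+ 2 i j ⟩
      2 ℕ.* i + 2 ℕ.* j            ∎)
    where
    open ℕP.≤-Reasoning
    even-bound : ∀ m → suc (4 ℕ.* m + 3) ≡ 2 ℕ.* suc (suc (2 ℕ.* m))
    even-bound = solve-∀

-- Integer arrays f i j; their shifts are the coefficient arrays of p·f,
-- q·f and pq·f.
Array : Set
Array = ℕ → ℕ → ℤ

shp : Array → Array
shp f zero    j = + 0
shp f (suc i) j = f i j

shq : Array → Array
shq f i zero    = + 0
shq f i (suc j) = f i j

shpq : Array → Array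
shpq f = shp (shq f)

weightA : ℕ → Array → Array
weightA n f i j = + 2 ℤ.* (n ℤ.⊖ (i + j)) ℤ.* f i j

weightB : ℕ → Array → Array
weightB n f i j = (+ 1 ℤ.+ + 2 ℤ.* (n ℤ.⊖ (i + j))) ℤ.* f i j

-- Right-hand sides of the recurrences  d_{2m+1} = RA (2m) d_{2m}  and
-- d_{2m+2} = RB (2m+1) d_{2m+1}; the three summands come from the three
-- terms of D (through X, Y and Z respectively).
RA : ℕ → Array → Array
RA n f i j = + suc (double i) ℤ.* shq f i j ℤ.+ + suc (double j) ℤ.* shp f i j
             ℤ.+ shpq (weightA n f) i j

RB : ℕ → Array → Array
RB n f i j = + suc (double i) ℤ.* f i j ℤ.+ + double (suc j) ℤ.* shp f i (suc j)
             ℤ.+ shp (weightB n f) i j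

VanishesFrom : ℕ → Array → Set
VanishesFrom N f = ∀ i j → N ≤ i + j → f i j ≡ + 0

shp-vanishes : ∀ {N f} → VanishesFrom N f → VanishesFrom (suc N) (shp f)
shp-vanishes v zero    j _  = refl
shp-vanishes v (suc i) j le = v i j (ℕP.≤-pred le)

shq-vanishes : ∀ {N f} → VanishesFrom N f → VanishesFrom (suc N) (shq f)
shq-vanishes v i zero    _  = refl
shq-vanishes {N} v i (suc j) le = v i j (ℕP.≤-pred (subst (suc N ≤_) (ℕP.+-suc i j) le))

-- On the boundary i + j = n the weight 2(n-i-j) is zero, beyond it f is.
weightA-vanishes : ∀ {n f} → VanishesFrom (suc n) f → VanishesFrom n (weightA n f)
weightA-vanishes {n} {f} v i j le with ℕP.m≤n⇒m<n∨m≡n le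
... | inj₁ n<i+j = trans (cong (w ℤ.*_) (v i j n<i+j)) (ℤP.*-zeroʳ w)
  where
  w : ℤ
  w = + 2 ℤ.* (n ℤ.⊖ (i + j))
... | inj₂ refl  = cong (λ w → + 2 ℤ.* w ℤ.* f i j) (ℤP.n⊖n≡0 (i + j))

weightB-vanishes : ∀ {N n f} → VanishesFrom N f → VanishesFrom N (weightB n f)
weightB-vanishes {n = n} v i j le =
  trans (cong (w ℤ.*_) (v i j le)) (ℤP.*-zeroʳ w)
  where
  w : ℤ
  w = + 1 ℤ.+ + 2 ℤ.* (n ℤ.⊖ (i + j))

vanish₃ : ∀ a b {x y z} → x ≡ + 0 → y ≡ + 0 → z ≡ + 0 → a ℤ.* x ℤ.+ b ℤ.* y ℤ.+ z ≡ + 0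
vanish₃ a b refl refl refl = cong₂ ℤ._+_ (cong₂ ℤ._+_ (ℤP.*-zeroʳ a) (ℤP.*-zeroʳ b)) refl

RA-vanishes : ∀ {n f} → VanishesFrom (suc n) f → VanishesFrom (suc (suc n)) (RA n f)
RA-vanishes v i j le =
  vanish₃ (+ suc (double i)) (+ suc (double j)) (shq-vanishes v i j le) (shp-vanishes v i j le)
              (shp-vanishes (shq-vanishes (weightA-vanishes v)) i j le)

RB-vanishes : ∀ {n f} → VanishesFrom (suc n) f → VanishesFrom (suc (suc n)) (RB n f)
RB-vanishes v i j le =
  vanish₃ (+ suc (double i)) (+ double (suc j)) (v i j (ℕP.≤-trans (ℕP.n≤1+n _) le))
              (shp-vanishes v i (suc j) (ℕP.≤-trans le (ℕP.+-monoʳ-≤ i (ℕP.n≤1+n j))))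
              (shp-vanishes (weightB-vanishes v) i j le)

⊖-within : ∀ a t {n} → a + t ≡ n → n ℤ.⊖ a ≡ + t
⊖-within a t refl = trans (ℤP.⊖-≥ (ℕP.m≤m+n a t)) (cong +_ (ℕP.m+n∸m≡n a t))

pos-double : ∀ t → + double t ≡ + 2 ℤ.* + t
pos-double t = trans (cong +_ (double≡2* t)) (ℤP.pos-* 2 t)

-- Recurrence A.  (DX)^(2m+1)(Y) = D(X·P) with P = (DX)^(2m)(Y); the
-- coefficient of X^(2i) Y^(2j) Z^(2t+1) in D(X·P) is the sum of the three
-- contributions below, each a coefficient of P read off as some d_{2m,·,·}.
module RecurrenceA (m : ℕ) where

  private
    P : Poly
    P = DXpow (double m)

  through-X : ∀ i j t → i + j + t ≡ suc (double m) →
              derX (mulX P) (double i) (double j) (suc (double t)) ≡ + suc (double i) ℤ.* shq (dEven m) i j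
  through-X i zero    t e = sym (ℤP.*-zeroʳ (+ suc (double i)))
  through-X i (suc j) t e =
    cong (+ suc (double i) ℤ.*_) (sym (dEven-within m i j t (ℕP.suc-injective (trans (sym (suc-mid i j t)) e))))

  through-Y : ∀ i j t → i + j + t ≡ suc (double m) →
              derY (mulX P) (double i) (double j) (suc (double t)) ≡ + suc (double j) ℤ.* shp (dEven m) i j
  through-Y zero    j t e = sym (ℤP.*-zeroʳ (+ suc (double j)))
  through-Y (suc i) j t e = cong (+ suc (double j) ℤ.*_) (sym (dEven-within m i j t (ℕP.suc-injective e)))

  through-Z : ∀ i j t → i + j + t ≡ suc (double m) →
              derZ (mulX P) (double i) (double j) (suc (double t)) ≡ shpq (weightA (double m) (dEven m)) i j
  through-Z zero    j       t e = refl
  through-Z (suc i) zero    t e = refl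
  through-Z (suc i) (suc j) t e = cong₂ ℤ._*_ weight (sym (dEven-within m i j (suc t) e′))
    where
    e′ : i + j + suc t ≡ double m
    e′ = ℕP.suc-injective (trans (cong suc (trans (suc-end i j t) (sym (suc-mid i j t)))) e)
    weight : + double (suc t) ≡ + 2 ℤ.* (double m ℤ.⊖ (i + j))
    weight = trans (pos-double (suc t)) (cong (+ 2 ℤ.*_) (sym (⊖-within (i + j) (suc t) e′)))

  recurrence : ∀ i j → dOdd m i j ≡ RA (double m) (dEven m) i j
  recurrence i j with compare (i + j) (suc (double m))
  ... | within t e = trans (dOdd-within m i j t e)
          (cong₂ ℤ._+_ (cong₂ ℤ._+_ (through-X i j t e) (through-Y i j t e)) (through-Z i j t e))
  ... | beyond lt  = trans (dOdd-past m i j lt) (sym (RA-vanishes (dEven-past m) i j lt))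

-- Recurrence B.  (DX)^(2m+2)(Y) = D(X·Q) with Q = (DX)^(2m+1)(Y); the
-- coefficient of X^(2i) Y^(2j+1) Z^(2t) in D(X·Q) is again a sum of three
-- contributions.  When t = 0 those through X and Y are absent, matching
-- coefficients d_{2m+1,·,·} beyond their range.
module RecurrenceB (m : ℕ) where

  private
    Q : Poly
    Q = DXpow (suc (double m))

    past-end : ∀ i j → i + j + 0 ≡ suc (suc (double m)) → suc (double m) < i + j
    past-end i j e = ℕP.≤-reflexive (sym (trans (sym (ℕP.+-identityʳ (i + j))) e))

  through-X : ∀ i j t → i + j + t ≡ suc (suc (double m)) →
              derX (mulX Q) (double i) (suc (double j)) (double t) ≡ + suc (double i) ℤ.* dOdd m i j
  through-X i j zero    e = sym (trans (cong (+ suc (double i) ℤ.*_) (dOdd-past m i j (past-end i j e)))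
                                       (ℤP.*-zeroʳ (+ suc (double i))))
  through-X i j (suc t) e =
    cong (+ suc (double i) ℤ.*_) (sym (dOdd-within m i j t (ℕP.suc-injective (trans (sym (suc-end i j t)) e))))

  through-Y : ∀ i j t → i + j + t ≡ suc (suc (double m)) →
              derY (mulX Q) (double i) (suc (double j)) (double t) ≡ + double (suc j) ℤ.* shp (dOdd m) i (suc j)
  through-Y zero    j t       e = sym (ℤP.*-zeroʳ (+ double (suc j)))
  through-Y (suc i) j zero    e = sym (trans (cong (+ double (suc j) ℤ.*_)
                                                   (dOdd-past m i (suc j) (past-end i (suc j) (trans (suc-mid i j 0) e))))
                                             (ℤP.*-zeroʳ (+ double (suc j))))
  through-Y (suc i) j (suc t) e =
    cong (+ double (suc j) ℤ.*_) (sym (dOdd-within m i (suc j) t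
      (trans (trans (suc-mid i j t) (sym (suc-end i j t))) (ℕP.suc-injective e))))

  through-Z : ∀ i j t → i + j + t ≡ suc (suc (double m)) →
              derZ (mulX Q) (double i) (suc (double j)) (double t) ≡ shp (weightB (suc (double m)) (dOdd m)) i j
  through-Z zero    j t e = refl
  through-Z (suc i) j t e = cong₂ ℤ._*_ weight (sym (dOdd-within m i j t e′))
    where
    e′ : i + j + t ≡ suc (double m)
    e′ = ℕP.suc-injective e
    weight : + suc (double t) ≡ + 1 ℤ.+ + 2 ℤ.* (suc (double m) ℤ.⊖ (i + j))
    weight = cong (ℤ._+_ (+ 1)) (trans (pos-double t) (cong (+ 2 ℤ.*_) (sym (⊖-within (i + j) t e′))))

  recurrence : ∀ i j → dEven (suc m) i j ≡ RB (suc (double m)) (dOdd m) i j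
  recurrence i j with compare (i + j) (double (suc m))
  ... | within t e = trans (dEven-within (suc m) i j t e)
          (cong₂ ℤ._+_ (cong₂ ℤ._+_ (through-X i j t e) (through-Y i j t e)) (through-Z i j t e))
  ... | beyond lt  = trans (dEven-past (suc m) i j lt) (sym (RB-vanishes (dOdd-past m) i j lt))

ι : ℤ → ℚ
ι z = z ℚ./ 1

⟦_⟧ : ℕ → ℚ
⟦ n ⟧ = ι (+ n)

-- ι is a ring homomorphism.  Equalities of rationals are checked on the
-- unnormalised representatives, where z / (k+1) is represented by mkℚᵘ z k.
module _ where
  open ℚᵘ using (ℚᵘ; mkℚᵘ; *≡*; _≃_)

  private
    ≡-via : ∀ {p q : ℚ} (u : ℚᵘ) → ℚ.toℚᵘ p ≃ u → ℚ.toℚᵘ q ≃ u → p ≡ q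
    ≡-via u p≃u q≃u = ℚP.toℚᵘ-injective (ℚᵘP.≃-trans p≃u (ℚᵘP.≃-sym q≃u))

    toℚᵘ-/ : ∀ z k → ℚ.toℚᵘ (z ℚ./ suc k) ≃ mkℚᵘ z k
    toℚᵘ-/ z k = ℚP.toℚᵘ-fromℚᵘ (mkℚᵘ z k)

  ι-+ : ∀ a b → ι (a ℤ.+ b) ≡ ι a ℚ.+ ι b
  ι-+ a b = ≡-via (mkℚᵘ (a ℤ.+ b) 0) (toℚᵘ-/ (a ℤ.+ b) 0)
    (ℚᵘP.≃-trans (ℚP.toℚᵘ-homo-+ (ι a) (ι b))
      (ℚᵘP.≃-trans (ℚᵘP.+-cong (toℚᵘ-/ a 0) (toℚᵘ-/ b 0))
        (*≡* (cong (ℤ._* + 1) (cong₂ ℤ._+_ (ℤP.*-identityʳ a) (ℤP.*-identityʳ b))))))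

  ι-* : ∀ a b → ι (a ℤ.* b) ≡ ι a ℚ.* ι b
  ι-* a b = ≡-via (mkℚᵘ (a ℤ.* b) 0) (toℚᵘ-/ (a ℤ.* b) 0)
    (ℚᵘP.≃-trans (ℚP.toℚᵘ-homo-* (ι a) (ι b)) (ℚᵘP.*-cong (toℚᵘ-/ a 0) (toℚᵘ-/ b 0)))

  ι-neg : ∀ a → ι (ℤ.- a) ≡ ℚ.- ι a
  ι-neg a = ≡-via (mkℚᵘ (ℤ.- a) 0) (toℚᵘ-/ (ℤ.- a) 0)
    (ℚᵘP.≃-trans (ℚP.toℚᵘ-homo‿- (ι a)) (ℚᵘP.-‿cong {ℚ.toℚᵘ (ι a)} {mkℚᵘ a 0} (toℚᵘ-/ a 0)))

  /-as-* : ∀ z k .{{_ : ℕ.NonZero k}} → z ℚ./ k ≡ ι z ℚ.* (+ 1 ℚ./ k)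
  /-as-* z (suc k) = ≡-via (mkℚᵘ z k) (toℚᵘ-/ z k)
    (ℚᵘP.≃-trans (ℚP.toℚᵘ-homo-* (ι z) (+ 1 ℚ./ suc k))
      (ℚᵘP.≃-trans (ℚᵘP.*-cong (toℚᵘ-/ z 0) (toℚᵘ-/ (+ 1) k))
        (*≡* (cong₂ ℤ._*_ (ℤP.*-identityʳ z) (cong (λ d → + suc d) (sym (ℕP.+-identityʳ k)))))))

  cancel-factor : ∀ a k .{{_ : ℕ.NonZero k}} .{{_ : ℕ.NonZero (suc a ℕ.* k)}} →
                  ⟦ suc a ⟧ ℚ.* (+ 1 ℚ./ (suc a ℕ.* k)) ≡ + 1 ℚ./ k
  cancel-factor a (suc k) = ≡-via (mkℚᵘ (+ 1) k)
    (ℚᵘP.≃-trans (ℚP.toℚᵘ-homo-* ⟦ suc a ⟧ (+ 1 ℚ./ (suc a ℕ.* suc k)))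
      (ℚᵘP.≃-trans (ℚᵘP.*-cong (toℚᵘ-/ (+ suc a) 0) (toℚᵘ-/ (+ 1) (k ℕ.+ a ℕ.* suc k)))
        (*≡* cross)))
    (toℚᵘ-/ (+ 1) k)
    where
    cross : (+ suc a ℤ.* + 1) ℤ.* + suc k ≡ + 1 ℤ.* + suc ((k ℕ.+ a ℕ.* suc k) ℕ.+ 0)
    cross = begin
      (+ suc a ℤ.* + 1) ℤ.* + suc k          ≡⟨ cong (ℤ._* + suc k) (ℤP.*-identityʳ (+ suc a)) ⟩
      + suc a ℤ.* + suc k                    ≡⟨ ℤP.pos-* (suc a) (suc k) ⟨
      + suc (k ℕ.+ a ℕ.* suc k)              ≡⟨ cong (λ d → + suc d) (ℕP.+-identityʳ _) ⟨
      + suc ((k ℕ.+ a ℕ.* suc k) ℕ.+ 0)      ≡⟨ ℤP.*-identityˡ _ ⟨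
      + 1 ℤ.* + suc ((k ℕ.+ a ℕ.* suc k) ℕ.+ 0) ∎
      where open ≡-Reasoning

ι-⊖ : ∀ m n → ι (m ℤ.⊖ n) ≡ ⟦ m ⟧ ℚ.- ⟦ n ⟧
ι-⊖ m n = begin
  ι (m ℤ.⊖ n)             ≡⟨ cong ι (ℤP.[+m]-[+n]≡m⊖n m n) ⟨
  ι (+ m ℤ.+ ℤ.- + n)     ≡⟨ ι-+ (+ m) (ℤ.- + n) ⟩
  ⟦ m ⟧ ℚ.+ ι (ℤ.- + n)   ≡⟨ cong (ℚ._+_ ⟦ m ⟧) (ι-neg (+ n)) ⟩
  ⟦ m ⟧ ℚ.- ⟦ n ⟧         ∎
  where open ≡-Reasoning

⟦⟧-+ : ∀ m n → ⟦ m + n ⟧ ≡ ⟦ m ⟧ ℚ.+ ⟦ n ⟧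
⟦⟧-+ m n = trans (cong ι (ℤP.pos-+ m n)) (ι-+ (+ m) (+ n))

⟦⟧-double : ∀ n → ⟦ double n ⟧ ≡ 2ℚ ℚ.* ⟦ n ⟧
⟦⟧-double n = trans (cong ι (pos-double n)) (ι-* (+ 2) (+ n))

⟦⟧-odd : ∀ n → ⟦ suc (double n) ⟧ ≡ ℚ.1ℚ ℚ.+ 2ℚ ℚ.* ⟦ n ⟧
⟦⟧-odd n = trans (ι-+ (+ 1) (+ double n)) (cong (ℚ.1ℚ ℚ.+_) (⟦⟧-double n))

ι-sum₃ : ∀ a x b y z → ι (a ℤ.* x ℤ.+ b ℤ.* y ℤ.+ z) ≡ ι a ℚ.* ι x ℚ.+ ι b ℚ.* ι y ℚ.+ ι z
ι-sum₃ a x b y z = trans (ι-+ (a ℤ.* x ℤ.+ b ℤ.* y) z)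
  (cong (ℚ._+ ι z) (trans (ι-+ (a ℤ.* x) (b ℤ.* y)) (cong₂ ℚ._+_ (ι-* a x) (ι-* b y))))

-- The weights in ℚ, after the index shifts of the recurrences:
-- 2(n-(i-1)-(j-1)) and 1+2(n-(i-1)-j).
ℚweightA : ℕ → ℕ → ℕ → ℚ
ℚweightA n i j = 2ℚ ℚ.* (⟦ n ⟧ ℚ.- ⟦ i ∸ 1 ⟧ ℚ.- ⟦ j ∸ 1 ⟧)

ℚweightB : ℕ → ℕ → ℕ → ℚ
ℚweightB n i j = ℚ.1ℚ ℚ.+ 2ℚ ℚ.* (⟦ n ⟧ ℚ.- ⟦ i ∸ 1 ⟧ ℚ.- ⟦ j ⟧)

ι-⊖-sum : ∀ n i j → ι (n ℤ.⊖ (i + j)) ≡ ⟦ n ⟧ ℚ.- ⟦ i ⟧ ℚ.- ⟦ j ⟧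
ι-⊖-sum n i j = begin
  ι (n ℤ.⊖ (i + j))                ≡⟨ ι-⊖ n (i + j) ⟩
  ⟦ n ⟧ ℚ.- ⟦ i + j ⟧              ≡⟨ cong (ℚ._-_ ⟦ n ⟧) (⟦⟧-+ i j) ⟩
  ⟦ n ⟧ ℚ.- (⟦ i ⟧ ℚ.+ ⟦ j ⟧)      ≡⟨ solve 3 (λ N I J → N :- (I :+ J) := N :- I :- J) refl ⟦ n ⟧ ⟦ i ⟧ ⟦ j ⟧ ⟩
  ⟦ n ⟧ ℚ.- ⟦ i ⟧ ℚ.- ⟦ j ⟧        ∎
  where open ≡-Reasoning

ι-weightA : ∀ n f i j → ι (shpq (weightA n f) i j) ≡ ℚweightA n i j ℚ.* ι (shpq f i j)
ι-weightA n f zero    j       = sym (ℚP.*-zeroʳ (ℚweightA n zero j))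
ι-weightA n f (suc i) zero    = sym (ℚP.*-zeroʳ (ℚweightA n (suc i) zero))
ι-weightA n f (suc i) (suc j) = trans (ι-* (+ 2 ℤ.* w) (f i j))
  (cong (ℚ._* ι (f i j)) (trans (ι-* (+ 2) w) (cong (2ℚ ℚ.*_) (ι-⊖-sum n i j))))
  where
  w : ℤ
  w = n ℤ.⊖ (i + j)

ι-weightB : ∀ n f i j → ι (shp (weightB n f) i j) ≡ ℚweightB n i j ℚ.* ι (shp f i j)
ι-weightB n f zero    j = sym (ℚP.*-zeroʳ (ℚweightB n zero j))
ι-weightB n f (suc i) j = trans (ι-* (+ 1 ℤ.+ + 2 ℤ.* w) (f i j))
  (cong (ℚ._* ι (f i j)) (trans (ι-+ (+ 1) (+ 2 ℤ.* w))
    (cong (ℚ.1ℚ ℚ.+_) (trans (ι-* (+ 2) w) (cong (2ℚ ℚ.*_) (ι-⊖-sum n i j))))))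
  where
  w : ℤ
  w = n ℤ.⊖ (i + j)

ι-RA : ∀ n f i j → ι (RA n f i j) ≡
  (ℚ.1ℚ ℚ.+ 2ℚ ℚ.* ⟦ i ⟧) ℚ.* ι (shq f i j) ℚ.+ (ℚ.1ℚ ℚ.+ 2ℚ ℚ.* ⟦ j ⟧) ℚ.* ι (shp f i j)
  ℚ.+ ℚweightA n i j ℚ.* ι (shpq f i j)
ι-RA n f i j = trans (ι-sum₃ (+ suc (double i)) (shq f i j) (+ suc (double j)) (shp f i j) (shpq (weightA n f) i j))
  (cong₂ ℚ._+_ (cong₂ ℚ._+_ (cong (ℚ._* ι (shq f i j)) (⟦⟧-odd i)) (cong (ℚ._* ι (shp f i j)) (⟦⟧-odd j)))
               (ι-weightA n f i j))

ι-RB : ∀ n f i j → ι (RB n f i j) ≡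
  (ℚ.1ℚ ℚ.+ 2ℚ ℚ.* ⟦ i ⟧) ℚ.* ι (f i j) ℚ.+ 2ℚ ℚ.* ⟦ suc j ⟧ ℚ.* ι (shp f i (suc j))
  ℚ.+ ℚweightB n i j ℚ.* ι (shp f i j)
ι-RB n f i j = trans (ι-sum₃ (+ suc (double i)) (f i j) (+ double (suc j)) (shp f i (suc j)) (shp (weightB n f) i j))
  (cong₂ ℚ._+_ (cong₂ ℚ._+_ (cong (ℚ._* ι (f i j)) (⟦⟧-odd i)) (cong (ℚ._* ι (shp f i (suc j))) (⟦⟧-double (suc j))))
               (ι-weightB n f i j))

𝓐 : PS → PS
𝓐 F = mul-p F ⊕ mul-q F
      ⊕ 2ℚ ⊙ (mul-p (mul-q (∂p F)) ⊖ mul-p (mul-p (mul-q (∂p F))))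
      ⊕ 2ℚ ⊙ (mul-p (mul-q (∂q F)) ⊖ mul-p (mul-q (mul-q (∂q F))))
      ⊕ 2ℚ ⊙ mul-p (mul-q (mul-x (∂x F)))

𝓑 : PS → PS
𝓑 F = F ⊕ mul-p F
      ⊕ 2ℚ ⊙ (mul-p (∂p F) ⊖ mul-p (mul-p (∂p F)))
      ⊕ 2ℚ ⊙ (mul-p (∂q F) ⊖ mul-p (mul-q (∂q F)))
      ⊕ 2ℚ ⊙ mul-p (mul-x (∂x F))

p∂p : ∀ F n i j → mul-p (∂p F) n i j ≡ ⟦ i ⟧ ℚ.* F n i j
p∂p F n zero    j = sym (ℚP.*-zeroˡ (F n zero j))
p∂p F n (suc i) j = refl

q∂q : ∀ F n i j → mul-q (∂q F) n i j ≡ ⟦ j ⟧ ℚ.* F n i j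
q∂q F n i zero    = sym (ℚP.*-zeroˡ (F n i zero))
q∂q F n i (suc j) = refl

x∂x : ∀ F n i j → mul-x (∂x F) n i j ≡ ⟦ n ⟧ ℚ.* F n i j
x∂x F zero    i j = sym (ℚP.*-zeroˡ (F zero i j))
x∂x F (suc n) i j = refl

mul-p-scaled : ∀ {G H : PS} {n} (c : ℕ → ℕ → ℚ) → (∀ i j → G n i j ≡ c i j ℚ.* H n i j) →
               ∀ i j → mul-p G n i j ≡ c (i ∸ 1) j ℚ.* mul-p H n i j
mul-p-scaled c h zero    j = sym (ℚP.*-zeroʳ (c zero j))
mul-p-scaled c h (suc i) j = h i j

mul-q-scaled : ∀ {G H : PS} {n} (c : ℕ → ℕ → ℚ) → (∀ i j → G n i j ≡ c i j ℚ.* H n i j) →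
               ∀ i j → mul-q G n i j ≡ c i (j ∸ 1) ℚ.* mul-q H n i j
mul-q-scaled c h i zero    = sym (ℚP.*-zeroʳ (c i zero))
mul-q-scaled c h i (suc j) = h i j

mul-p-mul-q : ∀ G n i j → mul-p (mul-q G) n i j ≡ mul-q (mul-p G) n i j
mul-p-mul-q G n zero    zero    = refl
mul-p-mul-q G n zero    (suc j) = refl
mul-p-mul-q G n (suc i) zero    = refl
mul-p-mul-q G n (suc i) (suc j) = refl

p∂q : ∀ F n i j → mul-p (∂q F) n i j ≡ ⟦ suc j ⟧ ℚ.* mul-p F n i (suc j)
p∂q F n zero    j = sym (ℚP.*-zeroʳ ⟦ suc j ⟧)
p∂q F n (suc i) j = refl

pq∂p : ∀ F n i j → mul-p (mul-q (∂p F)) n i j ≡ ⟦ i ⟧ ℚ.* mul-q F n i j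
pq∂p F n i j = trans (mul-p-mul-q (∂p F) n i j) (mul-q-scaled (λ i _ → ⟦ i ⟧) (p∂p F n) i j)

pq∂q : ∀ F n i j → mul-p (mul-q (∂q F)) n i j ≡ ⟦ j ⟧ ℚ.* mul-p F n i j
pq∂q F n i j = mul-p-scaled (λ _ j → ⟦ j ⟧) (q∂q F n) i j

𝓐-coefficient : ∀ F n i j → 𝓐 F n i j ≡
  (ℚ.1ℚ ℚ.+ 2ℚ ℚ.* ⟦ i ⟧) ℚ.* mul-q F n i j ℚ.+ (ℚ.1ℚ ℚ.+ 2ℚ ℚ.* ⟦ j ⟧) ℚ.* mul-p F n i j
  ℚ.+ ℚweightA n i j ℚ.* mul-p (mul-q F) n i j
𝓐-coefficient F n i j = trans
  (cong₂ ℚ._+_ (cong₂ ℚ._+_ (cong (ℚ._+_ (P ℚ.+ Q)) (cong (2ℚ ℚ.*_) (cong₂ ℚ._-_ (pq∂p F n i j) ppq∂p)))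
                            (cong (2ℚ ℚ.*_) (cong₂ ℚ._-_ (pq∂q F n i j) pqq∂q)))
               (cong (2ℚ ℚ.*_) pqx∂x))
  (solve 8 (λ P Q R I I′ J J′ N →
       P :+ Q :+ con 2ℚ :* (I :* Q :- I′ :* R) :+ con 2ℚ :* (J :* P :- J′ :* R) :+ con 2ℚ :* (N :* R)
    := (con ℚ.1ℚ :+ con 2ℚ :* I) :* Q :+ (con ℚ.1ℚ :+ con 2ℚ :* J) :* P :+ con 2ℚ :* (N :- I′ :- J′) :* R)
    refl P Q R ⟦ i ⟧ ⟦ i ∸ 1 ⟧ ⟦ j ⟧ ⟦ j ∸ 1 ⟧ ⟦ n ⟧)
  where
  P : ℚ
  P = mul-p F n i j
  Q : ℚ
  Q = mul-q F n i j
  R : ℚ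
  R = mul-p (mul-q F) n i j
  ppq∂p : mul-p (mul-p (mul-q (∂p F))) n i j ≡ ⟦ i ∸ 1 ⟧ ℚ.* R
  ppq∂p = mul-p-scaled (λ i _ → ⟦ i ⟧) (pq∂p F n) i j
  pqq∂q : mul-p (mul-q (mul-q (∂q F))) n i j ≡ ⟦ j ∸ 1 ⟧ ℚ.* R
  pqq∂q = mul-p-scaled (λ _ j → ⟦ j ∸ 1 ⟧) (mul-q-scaled (λ _ j → ⟦ j ⟧) (q∂q F n)) i j
  pqx∂x : mul-p (mul-q (mul-x (∂x F))) n i j ≡ ⟦ n ⟧ ℚ.* R
  pqx∂x = mul-p-scaled (λ _ _ → ⟦ n ⟧) (mul-q-scaled (λ _ _ → ⟦ n ⟧) (x∂x F n)) i j

𝓑-coefficient : ∀ F n i j → 𝓑 F n i j ≡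
  (ℚ.1ℚ ℚ.+ 2ℚ ℚ.* ⟦ i ⟧) ℚ.* F n i j ℚ.+ 2ℚ ℚ.* ⟦ suc j ⟧ ℚ.* mul-p F n i (suc j)
  ℚ.+ ℚweightB n i j ℚ.* mul-p F n i j
𝓑-coefficient F n i j = trans
  (cong₂ ℚ._+_ (cong₂ ℚ._+_ (cong (ℚ._+_ (E ℚ.+ P)) (cong (2ℚ ℚ.*_) (cong₂ ℚ._-_ (p∂p F n i j) pp∂p)))
                            (cong (2ℚ ℚ.*_) (cong₂ ℚ._-_ (p∂q F n i j) (pq∂q F n i j))))
               (cong (2ℚ ℚ.*_) px∂x))
  (solve 8 (λ E P P⁺ I I′ J J⁺ N →
       E :+ P :+ con 2ℚ :* (I :* E :- I′ :* P) :+ con 2ℚ :* (J⁺ :* P⁺ :- J :* P) :+ con 2ℚ :* (N :* P)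
    := (con ℚ.1ℚ :+ con 2ℚ :* I) :* E :+ con 2ℚ :* J⁺ :* P⁺ :+ (con ℚ.1ℚ :+ con 2ℚ :* (N :- I′ :- J)) :* P)
    refl E P (mul-p F n i (suc j)) ⟦ i ⟧ ⟦ i ∸ 1 ⟧ ⟦ j ⟧ ⟦ suc j ⟧ ⟦ n ⟧)
  where
  E : ℚ
  E = F n i j
  P : ℚ
  P = mul-p F n i j
  pp∂p : mul-p (mul-p (∂p F)) n i j ≡ ⟦ i ∸ 1 ⟧ ℚ.* P
  pp∂p = mul-p-scaled (λ i _ → ⟦ i ⟧) (p∂p F n) i j
  px∂x : mul-p (mul-x (∂x F)) n i j ≡ ⟦ n ⟧ ℚ.* P
  px∂x = mul-p-scaled (λ _ _ → ⟦ n ⟧) (x∂x F n) i j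

Slice : PS → ℕ → Array → ℚ → Set
Slice F n f X = ∀ i j → F n i j ≡ ι (f i j) ℚ.* X

slice-p : ∀ {F n f X} → Slice F n f X → Slice (mul-p F) n (shp f) X
slice-p {X = X} s zero    j = sym (ℚP.*-zeroˡ X)
slice-p         s (suc i) j = s i j

slice-q : ∀ {F n f X} → Slice F n f X → Slice (mul-q F) n (shq f) X
slice-q {X = X} s i zero    = sym (ℚP.*-zeroˡ X)
slice-q         s i (suc j) = s i j

distrib₃ : ∀ a x b y c z X →
  (a ℚ.* x ℚ.+ b ℚ.* y ℚ.+ c ℚ.* z) ℚ.* X ≡ a ℚ.* (x ℚ.* X) ℚ.+ b ℚ.* (y ℚ.* X) ℚ.+ c ℚ.* (z ℚ.* X)
distrib₃ = solve 7 (λ a x b y c z X → (a :* x :+ b :* y :+ c :* z) :* X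
                                      := a :* (x :* X) :+ b :* (y :* X) :+ c :* (z :* X)) refl

∂x-slice : ∀ {G n g X Y} → Slice G (suc n) g Y → ⟦ suc n ⟧ ℚ.* Y ≡ X → Slice (∂x G) n g X
∂x-slice {G} {n} {g} {X} {Y} s step i j = begin
  ⟦ suc n ⟧ ℚ.* G (suc n) i j        ≡⟨ cong (⟦ suc n ⟧ ℚ.*_) (s i j) ⟩
  ⟦ suc n ⟧ ℚ.* (ι (g i j) ℚ.* Y)    ≡⟨ ℚP.*-assoc ⟦ suc n ⟧ (ι (g i j)) Y ⟨
  ⟦ suc n ⟧ ℚ.* ι (g i j) ℚ.* Y      ≡⟨ cong (ℚ._* Y) (ℚP.*-comm ⟦ suc n ⟧ (ι (g i j))) ⟩
  ι (g i j) ℚ.* ⟦ suc n ⟧ ℚ.* Y      ≡⟨ ℚP.*-assoc (ι (g i j)) ⟦ suc n ⟧ Y ⟩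
  ι (g i j) ℚ.* (⟦ suc n ⟧ ℚ.* Y)    ≡⟨ cong (ι (g i j) ℚ.*_) step ⟩
  ι (g i j) ℚ.* X                    ∎
  where open ≡-Reasoning

equationA-slice : ∀ {F G n f X Y} → Slice F n f X → Slice G (suc n) (RA n f) Y →
                  ⟦ suc n ⟧ ℚ.* Y ≡ X → ∀ i j → ∂x G n i j ≡ 𝓐 F n i j
equationA-slice {F} {G} {n} {f} {X} sF sG step i j = begin
  ∂x G n i j                                                       ≡⟨ ∂x-slice {G} {n} {RA n f} sG step i j ⟩
  ι (RA n f i j) ℚ.* X                                             ≡⟨ cong (ℚ._* X) (ι-RA n f i j) ⟩
  (a ℚ.* ι (shq f i j) ℚ.+ b ℚ.* ι (shp f i j) ℚ.+ w ℚ.* ι (shpq f i j)) ℚ.* X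
                                                                   ≡⟨ distrib₃ a _ b _ w _ X ⟩
  a ℚ.* (ι (shq f i j) ℚ.* X) ℚ.+ b ℚ.* (ι (shp f i j) ℚ.* X) ℚ.+ w ℚ.* (ι (shpq f i j) ℚ.* X)
    ≡⟨ cong₂ ℚ._+_ (cong₂ ℚ._+_ (cong (a ℚ.*_) (slice-q sF i j)) (cong (b ℚ.*_) (slice-p sF i j)))
                   (cong (w ℚ.*_) (slice-p (slice-q sF) i j)) ⟨
  a ℚ.* mul-q F n i j ℚ.+ b ℚ.* mul-p F n i j ℚ.+ w ℚ.* mul-p (mul-q F) n i j
                                                                   ≡⟨ 𝓐-coefficient F n i j ⟨
  𝓐 F n i j                                                        ∎
  where
  open ≡-Reasoning
  a : ℚ
  a = ℚ.1ℚ ℚ.+ 2ℚ ℚ.* ⟦ i ⟧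
  b : ℚ
  b = ℚ.1ℚ ℚ.+ 2ℚ ℚ.* ⟦ j ⟧
  w : ℚ
  w = ℚweightA n i j

equationB-slice : ∀ {F G n f X Y} → Slice F n f X → Slice G (suc n) (RB n f) Y →
                  ⟦ suc n ⟧ ℚ.* Y ≡ X → ∀ i j → ∂x G n i j ≡ 𝓑 F n i j
equationB-slice {F} {G} {n} {f} {X} sF sG step i j = begin
  ∂x G n i j                                                       ≡⟨ ∂x-slice {G} {n} {RB n f} sG step i j ⟩
  ι (RB n f i j) ℚ.* X                                             ≡⟨ cong (ℚ._* X) (ι-RB n f i j) ⟩
  (a ℚ.* ι (f i j) ℚ.+ b ℚ.* ι (shp f i (suc j)) ℚ.+ w ℚ.* ι (shp f i j)) ℚ.* X
                                                                   ≡⟨ distrib₃ a _ b _ w _ X ⟩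
  a ℚ.* (ι (f i j) ℚ.* X) ℚ.+ b ℚ.* (ι (shp f i (suc j)) ℚ.* X) ℚ.+ w ℚ.* (ι (shp f i j) ℚ.* X)
    ≡⟨ cong₂ ℚ._+_ (cong₂ ℚ._+_ (cong (a ℚ.*_) (sF i j)) (cong (b ℚ.*_) (slice-p sF i (suc j))))
                   (cong (w ℚ.*_) (slice-p sF i j)) ⟨
  a ℚ.* F n i j ℚ.+ b ℚ.* mul-p F n i (suc j) ℚ.+ w ℚ.* mul-p F n i j
                                                                   ≡⟨ 𝓑-coefficient F n i j ⟨
  𝓑 F n i j                                                        ∎
  where
  open ≡-Reasoning
  a : ℚ
  a = ℚ.1ℚ ℚ.+ 2ℚ ℚ.* ⟦ i ⟧
  b : ℚ
  b = 2ℚ ℚ.* ⟦ suc j ⟧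
  w : ℚ
  w = ℚweightB n i j

data Parity : ℕ → Set where
  even : ∀ m → Parity (double m)
  odd  : ∀ m → Parity (suc (double m))

parity : ∀ n → Parity n
parity zero = even zero
parity (suc n) with parity n
... | even m = odd m
... | odd  m = even (suc m)

module _ (i j : ℕ) where

  private
    half-step : ∀ n → suc (suc n) div 2 ≡ suc (n div 2)
    half-step n = m/n≡1+[m∸n]/n {suc (suc n)} (s≤s (s≤s z≤n))

    half-even : ∀ m → double m div 2 ≡ m
    half-even zero    = refl
    half-even (suc m) = trans (half-step (double m)) (cong suc (half-even m))

    half-odd : ∀ m → suc (double m) div 2 ≡ m
    half-odd zero    = refl
    half-odd (suc m) = trans (half-step (suc (double m))) (cong suc (half-odd m))

    even-rem : ∀ m → double m % 2 ≡ 0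
    even-rem zero    = refl
    even-rem (suc m) = even-rem m

    odd-rem : ∀ m → suc (double m) % 2 ≡ 1
    odd-rem zero    = refl
    odd-rem (suc m) = odd-rem m

    d-rem0 : ∀ n → n % 2 ≡ 0 → d n i j ≡ dEven (n div 2) i j
    d-rem0 n r with n % 2
    d-rem0 n refl | zero = refl

    d-rem1 : ∀ n → n % 2 ≡ 1 → d n i j ≡ dOdd (n div 2) i j
    d-rem1 n r with n % 2
    d-rem1 n refl | suc zero = refl

  d-even : ∀ m → d (double m) i j ≡ dEven m i j
  d-even m = trans (d-rem0 (double m) (even-rem m)) (cong (λ k → dEven k i j) (half-even m))

  d-odd : ∀ m → d (suc (double m)) i j ≡ dOdd m i j
  d-odd m = trans (d-rem1 (suc (double m)) (odd-rem m)) (cong (λ k → dOdd k i j) (half-odd m))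

invFact : ℕ → ℚ
invFact n = (+ 1 ℚ./ (n !)) {{n !≢0}}

invFact-step : ∀ n → ⟦ suc n ⟧ ℚ.* invFact (suc n) ≡ invFact n
invFact-step n = cancel-factor n (n !) {{n !≢0}} {{suc n !≢0}}

𝒟-slice : ∀ n → Slice 𝒟 n (d n) (invFact n)
𝒟-slice n i j = /-as-* (d n i j) (n !) {{n !≢0}}

neg-x-even : ∀ m F i j → neg-x F (double m) i j ≡ F (double m) i j
neg-x-even zero    F i j = refl
neg-x-even (suc m) F i j =
  trans (⁻¹-involutive _) (neg-x-even m (λ k → F (suc (suc k))) i j)

neg-x-odd : ∀ m F i j → neg-x F (suc (double m)) i j ≡ ℚ.- F (suc (double m)) i j
neg-x-odd m F i j = cong ℚ.-_ (neg-x-even m (λ k → F (suc k)) i j)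

DE-even : ∀ m → Slice DE (double m) (dEven m) (invFact (double m))
DE-even m i j = begin
  ½ ℚ.* (x ℚ.+ neg-x 𝒟 (double m) i j)   ≡⟨ cong (λ y → ½ ℚ.* (x ℚ.+ y)) (neg-x-even m 𝒟 i j) ⟩
  ½ ℚ.* (x ℚ.+ x)                        ≡⟨ solve 1 (λ x → con ½ :* (x :+ x) := x) refl x ⟩
  x                                      ≡⟨ 𝒟-slice (double m) i j ⟩
  ι (d (double m) i j) ℚ.* invFact (double m) ≡⟨ cong (λ z → ι z ℚ.* invFact (double m)) (d-even i j m) ⟩
  ι (dEven m i j) ℚ.* invFact (double m) ∎
  where
  open ≡-Reasoning
  x : ℚ
  x = 𝒟 (double m) i j

DO-odd : ∀ m → Slice DO (suc (double m)) (dOdd m) (invFact (suc (double m)))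
DO-odd m i j = begin
  ½ ℚ.* (x ℚ.- neg-x 𝒟 n i j)            ≡⟨ cong (λ y → ½ ℚ.* (x ℚ.- y)) (neg-x-odd m 𝒟 i j) ⟩
  ½ ℚ.* (x ℚ.- ℚ.- x)                    ≡⟨ solve 1 (λ x → con ½ :* (x :- :- x) := x) refl x ⟩
  x                                      ≡⟨ 𝒟-slice n i j ⟩
  ι (d n i j) ℚ.* invFact n              ≡⟨ cong (λ z → ι z ℚ.* invFact n) (d-odd i j m) ⟩
  ι (dOdd m i j) ℚ.* invFact n           ∎
  where
  open ≡-Reasoning
  n : ℕ
  n = suc (double m)
  x : ℚ
  x = 𝒟 n i j

DE-odd : ∀ m i j → DE (suc (double m)) i j ≡ ℚ.0ℚ
DE-odd m i j = trans (cong (λ y → ½ ℚ.* (x ℚ.+ y)) (neg-x-odd m 𝒟 i j))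
                     (solve 1 (λ x → con ½ :* (x :+ :- x) := con ℚ.0ℚ) refl x)
  where
  x : ℚ
  x = 𝒟 (suc (double m)) i j

DO-even : ∀ m i j → DO (double m) i j ≡ ℚ.0ℚ
DO-even m i j = trans (cong (λ y → ½ ℚ.* (x ℚ.- y)) (neg-x-even m 𝒟 i j))
                      (solve 1 (λ x → con ½ :* (x :- x) := con ℚ.0ℚ) refl x)
  where
  x : ℚ
  x = 𝒟 (double m) i j

zeros : Array
zeros _ _ = + 0

zero-slice : ∀ {F n} f → (∀ i j → F n i j ≡ ℚ.0ℚ) → Slice F n f ℚ.0ℚ
zero-slice f z i j = trans (z i j) (sym (ℚP.*-zeroʳ (ι (f i j))))

slice-cong : ∀ {F n f g X} → (∀ i j → f i j ≡ g i j) → Slice F n f X → Slice F n g X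
slice-cong {X = X} f≡g s i j = trans (s i j) (cong (λ z → ι z ℚ.* X) (f≡g i j))

-- The two equations of the lemma, at every coefficient.  At the slices
-- where the data of the recurrence are absent both sides vanish.
equationA : ∀ n i j → ∂x DO n i j ≡ 𝓐 DE n i j
equationA n with parity n
... | even m = equationA-slice {DE} {DO} {double m} {dEven m} (DE-even m)
                 (slice-cong {DO} {suc (double m)} (RecurrenceA.recurrence m) (DO-odd m))
                 (invFact-step (double m))
... | odd  m = equationA-slice {DE} {DO} {n} {zeros}
                 (zero-slice {DE} {n} zeros (DE-odd m))
                 (zero-slice {DO} {suc n} (RA n zeros) (DO-even (suc m))) (ℚP.*-zeroʳ ⟦ suc n ⟧)

equationB : ∀ n i j → ∂x DE n i j ≡ 𝓑 DO n i j
equationB n with parity n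
... | even m = equationB-slice {DO} {DE} {n} {zeros}
                 (zero-slice {DO} {n} zeros (DO-even m))
                 (zero-slice {DE} {suc n} (RB n zeros) (DE-odd m)) (ℚP.*-zeroʳ ⟦ suc n ⟧)
... | odd  m = equationB-slice {DO} {DE} {suc (double m)} {dOdd m} (DO-odd m)
                 (slice-cong {DE} {double (suc m)} (RecurrenceB.recurrence m) (DE-even (suc m)))
                 (invFact-step (suc (double m)))

lemma3p6 : (∀ n i j → ∂x DO n i j
                 ≡ (mul-p DE ⊕ mul-q DE
                    ⊕ 2ℚ ⊙ (mul-p (mul-q (∂p DE)) ⊖ mul-p (mul-p (mul-q (∂p DE))))
                    ⊕ 2ℚ ⊙ (mul-p (mul-q (∂q DE)) ⊖ mul-p (mul-q (mul-q (∂q DE))))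
                    ⊕ 2ℚ ⊙ mul-p (mul-q (mul-x (∂x DE)))) n i j)
             × (∀ n i j → ∂x DE n i j
                 ≡ (DO ⊕ mul-p DO
                    ⊕ 2ℚ ⊙ (mul-p (∂p DO) ⊖ mul-p (mul-p (∂p DO)))
                    ⊕ 2ℚ ⊙ (mul-p (∂q DO) ⊖ mul-p (mul-q (∂q DO)))
                    ⊕ 2ℚ ⊙ mul-p (mul-x (∂x DO))) n i j)
lemma3p6 = equationA , equationB
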